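{- A strong proximity $\vee$-semilattice is localized if and only if it (i.e. its underlying proximity poset) admits a coalgebra structure for the double powerlocale comonad $\mathrm{P_U}\circ\mathrm{P_L}$ over $\mathsf{PxPos}$.
   Context: Work constructively; $\mathrm{Fin}(S)$ = finitely enumerable subsets, $\mathrm{Fin}^+(A)$ = inhabited finitely enumerable subsets of $A$. Proximity poset: $(S,\le,\prec)$, $(S,\le)$ a poset and $\prec$ a relation with $\{b\mid b\prec a\}$ a rounded ideal (downward closed, inhabited, directed $I$ with $x\in I\iff\exists y\,(x\prec y\ \&\ y\in I)$) and $\{b\mid a\prec b\}$ a rounded upward closed set ($x\in U\iff\exists y\,(y\prec x\ \&\ y\in U)$) for each $a$. Approximable relations: $r\subseteq S\times S'$ with each $\{a\mid a\,r\,b\}$ a rounded ideal and each $\{b\mid a\,r\,b\}$ a rounded upward closed set; $\mathsf{PxPos}$ has identity $\prec$ and relational composition. A proximity $\vee$-semilattice is a proximity poset on a join-semilattice $(S,0,\vee)$; strong: $a\prec0\Rightarrow a=0$ and $a\prec b\vee c\Rightarrow\exists b',c'\,(a\le b'\vee c'\ \&\ b'\prec b\ \&\ c'\prec c)$; localized: $a\prec b\le c\vee d\Rightarrow\exists a_1,a_2\,(a_1\prec b\ \&\ a_1\prec c\ \&\ a_2\prec b\ \&\ a_2\prec d\ \&\ a\prec a_1\vee a_2)$. For $r\subseteq X\times Y$: $A\,r_L\,B\iff\forall a\in A\,\exists b\in B\,(a\,r\,b)$, $A\,r_U\,B\iff\forall b\in B\,\exists a\in A\,(a\,r\,b)$.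 Comonad $\mathrm{P_L}$: $\mathrm{P_L}(S)=((\mathrm{Fin}(S),\le_L),\prec_L)$ (poset reflection), $\mathrm{P_L}(r)=r_L$, counit $A\,\varepsilon^L_S\,a\iff A\prec_L\{a\}$, comultiplication $A\,\nu^L_S\,\mathcal U\iff A\prec_L\bigcup\mathcal U$; $\mathrm{P_U}$ likewise with $U$. For $\mathcal U\in\mathrm{Fin}(\mathrm{Fin}(S))$: $\emptyset^*=\{\emptyset\}$, $(\mathcal U\cup\{A\})^*=\{B\cup C\mid B\in\mathcal U^*,C\in\mathrm{Fin}^+(A)\}$; $\mathcal U\,\sigma_S\,\mathcal V\iff\mathcal U\,(\prec_L)_U\,\mathcal V^*$. The double powerlocale $H=\mathrm{P_U}\circ\mathrm{P_L}$ has counit $\varepsilon^U_S\circ\mathrm{P_U}(\varepsilon^L_S)$ and comultiplication $\mathrm{P_U}(\sigma_{\mathrm{P_L}S})\circ\nu^U_{\mathrm{P_L}\mathrm{P_L}S}\circ\mathrm{P_U}(\nu^L_S)$. A coalgebra structure on $X$ is $\alpha:X\to HX$ with $\varepsilon_X\circ\alpha=\mathrm{id}_X$ and $\nu_X\circ\alpha=H\alpha\circ\alpha$. -}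

module Defs where

open import Data.List using (List; []; _∷_; _++_; map; concat; concatMap; [_])
open import Data.List.Relation.Unary.All using (All)
open import Data.List.Relation.Unary.Any using (Any)
open import Data.Product using (Σ; ∃; _×_; _,_)
open import Relation.Binary.PropositionalEquality using (_≡_)
open import Relation.Binary.Structures using (IsPartialOrder)
open import Relation.Binary.Lattice.Structures using (IsBoundedJoinSemilattice)
open import Function.Bundles using (_⇔_)

-- Relations, relational composition, lifts r_L and r_U
-- Fin(X) (finitely enumerable subsets) is represented by List X;
-- "a ∈ A" is list membership, so  A r_L B  is  ∀ a ∈ A ∃ b ∈ B (a r b).

Rel' : Set → Set → Set₁
Rel' X Y = X → Y → Set

_⊙_ : {X Y Z : Set} → Rel' Y Z → Rel' X Y → Rel' X Z
(s ⊙ r) a c = ∃ λ b → r a b × s b c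

_ᴸ : {X Y : Set} → Rel' X Y → Rel' (List X) (List Y)
(r ᴸ) A B = All (λ a → Any (λ b → r a b) B) A

_ᵁ : {X Y : Set} → Rel' X Y → Rel' (List X) (List Y)
(r ᵁ) A B = All (λ b → Any (λ a → r a b) A) B

record PxData : Set₁ where
  field
    Carrier : Set
    Le      : Rel' Carrier Carrier
    Prox    : Rel' Carrier Carrier

open PxData public

module _ (X : PxData) where
  private
    C = Carrier X

  record RoundedIdeal (I : C → Set) : Set where
    field
      downward  : ∀ {x y} → Le X x y → I y → I x
      inhabited : ∃ I
      directed  : ∀ {x y} → I x → I y → ∃ λ z → I z × Le X x z × Le X y z
      rounded   : ∀ x → I x ⇔ (∃ λ y → Prox X x y × I y)

  record RoundedUpper (U : C → Set) : Set where
    field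
      upward  : ∀ {x y} → Le X x y → U x → U y
      rounded : ∀ x → U x ⇔ (∃ λ y → Prox X y x × U y)

Approximable : (X Y : PxData) → Rel' (Carrier X) (Carrier Y) → Set
Approximable X Y r =
  (∀ b → RoundedIdeal X (λ a → r a b)) × (∀ a → RoundedUpper Y (λ b → r a b))

-- P_L(X) = ((Fin X, ≤_L), ≺_L); the poset reflection is left implicit:
-- all structure (approximable relations) is invariant under ≤_L-equivalence.

PL : PxData → PxData
PL X = record { Carrier = List (Carrier X) ; Le = (Le X) ᴸ ; Prox = (Prox X) ᴸ }

PU : PxData → PxData
PU X = record { Carrier = List (Carrier X) ; Le = (Le X) ᵁ ; Prox = (Prox X) ᵁ }

-- action on morphisms: P_L(r) = r_L, P_U(r) = r_U (the operators ᴸ, ᵁ)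

εL : (X : PxData) → Rel' (List (Carrier X)) (Carrier X)
εL X A a = ((Prox X) ᴸ) A [ a ]

νL : (X : PxData) → Rel' (List (Carrier X)) (List (List (Carrier X)))
νL X A 𝒰 = ((Prox X) ᴸ) A (concat 𝒰)

εU : (X : PxData) → Rel' (List (Carrier X)) (Carrier X)
εU X A a = ((Prox X) ᵁ) A [ a ]

νU : (X : PxData) → Rel' (List (Carrier X)) (List (List (Carrier X)))
νU X A 𝒰 = ((Prox X) ᵁ) A (concat 𝒰)

-- Fin⁺(A): the inhabited finitely enumerable subsets of A
-- (enumerated as the nonempty subsequences of the enumeration A)

subs : {X : Set} → List X → List (List X)
subs []       = [] ∷ []
subs (x ∷ xs) = map (x ∷_) (subs xs) ++ subs xs

Fin⁺ : {X : Set} → List X → List (List X)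
Fin⁺ []       = []
Fin⁺ (x ∷ xs) = map (x ∷_) (subs xs) ++ Fin⁺ xs

star : {X : Set} → List (List X) → List (List X)
star []      = [] ∷ []
star (A ∷ 𝒰) = concatMap (λ B → map (B ++_) (Fin⁺ A)) (star 𝒰)

σ : (X : PxData) → Rel' (List (List (Carrier X))) (List (List (Carrier X)))
σ X 𝒰 𝒱 = (((Prox X) ᴸ) ᵁ) 𝒰 (star 𝒱)

H : PxData → PxData
H X = PU (PL X)

Hmap : {X Y : PxData} → Rel' (Carrier X) (Carrier Y) → Rel' (Carrier (H X)) (Carrier (H Y))
Hmap r = (r ᴸ) ᵁ

εH : (X : PxData) → Rel' (Carrier (H X)) (Carrier X)
εH X = εU X ⊙ (εL X ᵁ)

νH : (X : PxData) → Rel' (Carrier (H X)) (Carrier (H (H X)))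
νH X = (σ (PL X) ᵁ) ⊙ (νU (PL (PL X)) ⊙ (νL X ᵁ))

-- coalgebra structure α : X → H X  (equality of morphisms = equality of relations)
record IsHCoalgebra (X : PxData) (α : Rel' (Carrier X) (Carrier (H X))) : Set where
  field
    approximable : Approximable X (H X) α
    counit-law   : ∀ x y → (εH X ⊙ α) x y ⇔ Prox X x y
    comult-law   : ∀ x 𝒲 → (νH X ⊙ α) x 𝒲 ⇔ (Hmap {X} {H X} α ⊙ α) x 𝒲

record ProxJoinSemilattice : Set₁ where
  field
    S        : Set
    _≤_      : Rel' S S
    _≺_      : Rel' S S
    _∨_      : S → S → S
    𝟘        : S
    isBoundedJoinSemilattice : IsBoundedJoinSemilattice _≡_ _≤_ _∨_ 𝟘

  pxData : PxData
  pxData = record { Carrier = S ; Le = _≤_ ; Prox = _≺_ }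

  field
    lower-rounded : ∀ a → RoundedIdeal pxData (λ b → b ≺ a)
    upper-rounded : ∀ a → RoundedUpper pxData (λ b → a ≺ b)

module _ (L : ProxJoinSemilattice) where
  open ProxJoinSemilattice L

  record Strong : Set where
    field
      ≺𝟘   : ∀ {a} → a ≺ 𝟘 → a ≡ 𝟘
      ≺∨   : ∀ {a b c} → a ≺ (b ∨ c) →
             ∃ λ b' → ∃ λ c' → (a ≤ (b' ∨ c')) × (b' ≺ b) × (c' ≺ c)

  Localized : Set
  Localized = ∀ {a b c d} → a ≺ b → b ≤ (c ∨ d) →
    ∃ λ a₁ → ∃ λ a₂ → (a₁ ≺ b) × (a₁ ≺ c) × (a₂ ≺ b) × (a₂ ≺ d) × (a ≺ (a₁ ∨ a₂))

-- Every iterated powerlocale P of S receives a canonical approximable relation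
-- η_P from S: x η_L A means x ≺ ⋁ A, and x η_U 𝒜 means x ≺ y for some y that is
-- η-related to every member of 𝒜.  The candidate coalgebra is α = η_{UL}, that is
-- x α 𝒰 iff x ≺ y ≺ ⋁ A for some y and all A ∈ 𝒰.  The lifts r_L, r_U, the
-- counits and the comultiplications all carry η to η, so both sides of each
-- coalgebra law equal η.  Only the distributive map σ needs more: it carries
-- η_{UL} to η_{LU} when finite meets of joins can be split into joins of meets,
-- and in a strong proximity ∨-semilattice this follows by iterating the binary
-- splitting of a ≺ b ≤ c ∨ d granted by localization.
--
-- Conversely, the counit law of a coalgebra α forces x α {{a}} ⇔ x ≺ a, and by
-- strength x α {A} ⇔ x ≺ ⋁ A.  Feeding the UL-element b ∧ (c ∨ d) through the
-- comultiplication law, σ turns it into (b ∧ c) ∨ (b ∧ d), and reading the result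
-- back through α gives the two pieces a₁, a₂ required by localization.

module Submission where

open import Data.List using (List; []; _∷_; _++_; [_]; map; concat; foldr)
open import Data.List.Membership.Propositional using (_∈_; find; lose)
open import Data.List.Membership.Propositional.Properties
  using (∈-++⁺ˡ; ∈-++⁺ʳ; ∈-++⁻; ∈-map⁺; ∈-map⁻; ∈-map∷⁻; ∈-concat⁺′; ∈-concat⁻′;
         ∈-concatMap⁺; ∈-concatMap⁻)
open import Data.List.Properties using (map-id; map-++; ++-identityʳ)
open import Data.List.Relation.Unary.All as All using (All; []; _∷_)
import Data.List.Relation.Unary.All.Properties as Allₚ
open import Data.List.Relation.Unary.Any as Any using (Any; here; there)
import Data.List.Relation.Unary.Any.Properties as Anyₚ
open import Data.Product using (∃; _×_; _,_; proj₁; proj₂)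
open import Data.Sum as Sum using (_⊎_; inj₁; inj₂)
open import Function using (id)
open import Function.Bundles using (_⇔_; mk⇔; Equivalence)
open import Function.Properties.Equivalence
  using (⇔-setoid) renaming (trans to ⇔-trans; sym to ⇔-sym)
open import Level using (0ℓ)
import Relation.Binary.Reasoning.Setoid as ≈-Reasoning
open import Relation.Binary.Lattice.Structures using (IsBoundedJoinSemilattice)
open import Relation.Binary.PropositionalEquality using (refl; sym; subst)

open import Defs

open Equivalence using (to; from)

private
  variable
    X Y Z : Set

ᴸ-trans : {R : Rel' X Y} {Q : Rel' Y Z} {T : Rel' X Z} →
          (∀ {a b c} → R a b → Q b c → T a c) →
          ∀ {A B C} → (R ᴸ) A B → (Q ᴸ) B C → (T ᴸ) A C
ᴸ-trans f rAB qBC = All.map (λ ra → let (b , b∈B , rab) = find ra in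
                               Any.map (f rab) (All.lookup qBC b∈B)) rAB

ᴸ-⊙⁻ : {P : Rel' X Y} {Q : Rel' Y Z} {A : List X} {C : List Z} →
       ((Q ⊙ P) ᴸ) A C → ((Q ᴸ) ⊙ (P ᴸ)) A C
ᴸ-⊙⁻ [] = [] , [] , []
ᴸ-⊙⁻ (qp ∷ qps) with find qp | ᴸ-⊙⁻ qps
... | c , c∈C , b , pab , qbc | B , pAB , qBC =
  b ∷ B , here pab ∷ All.map there pAB , lose c∈C qbc ∷ qBC

ᵁ-choose : {P : Y → Set} {Q : Rel' Y Z} {C : List Z} →
           All (λ c → ∃ λ b → P b × Q b c) C → ∃ λ B → All P B × (Q ᵁ) B C
ᵁ-choose [] = [] , [] , []
ᵁ-choose ((b , pb , qbc) ∷ rest) with ᵁ-choose rest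
... | B , pB , qBC = b ∷ B , pb ∷ pB , here qbc ∷ All.map there qBC

ᴸ-singleton⁻ : {R : Rel' X Y} {A : List X} {b : Y} → (R ᴸ) A [ b ] → All (λ a → R a b) A
ᴸ-singleton⁻ = All.map λ { (here rab) → rab }

ᴸ-concat : {R : Rel' X Y} {𝔄 : List (List X)} {𝔅 : List (List Y)} →
           ((R ᴸ) ᴸ) 𝔄 𝔅 → (R ᴸ) (concat 𝔄) (concat 𝔅)
ᴸ-concat r = Allₚ.concat⁺ (All.map (λ q → let (B , B∈𝔅 , rAB) = find q in
  All.map (λ ra → let (b , b∈B , rab) = find ra in lose (∈-concat⁺′ b∈B B∈𝔅) rab) rAB) r)

[]∈subs : (xs : List X) → [] ∈ subs xs
[]∈subs []       = here refl
[]∈subs (x ∷ xs) = ∈-++⁺ʳ (map (x ∷_) (subs xs)) ([]∈subs xs)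

[_]∈Fin⁺ : {x : X} {xs : List X} → x ∈ xs → [ x ] ∈ Fin⁺ xs
[_]∈Fin⁺ {xs = x ∷ xs} (here refl) = ∈-++⁺ˡ (∈-map⁺ (x ∷_) ([]∈subs xs))
[_]∈Fin⁺ {xs = x ∷ xs} (there x∈xs) = ∈-++⁺ʳ (map (x ∷_) (subs xs)) [ x∈xs ]∈Fin⁺

Fin⁺-meets : {C V : List X} → C ∈ Fin⁺ V → ∃ λ t → t ∈ C × t ∈ V
Fin⁺-meets {V = x ∷ xs} C∈ with ∈-++⁻ (map (x ∷_) (subs xs)) C∈
... | inj₁ C∈x∷subs = x , ∈-map∷⁻ C∈x∷subs , here refl
... | inj₂ C∈Fin⁺ with Fin⁺-meets C∈Fin⁺
...   | t , t∈C , t∈xs = t , t∈C , there t∈xs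

star-meets : {C V : List X} {𝒱 : List (List X)} → C ∈ star 𝒱 → V ∈ 𝒱 → ∃ λ t → t ∈ V × t ∈ C
star-meets {𝒱 = W ∷ 𝒱} C∈ V∈
  with find (∈-concatMap⁻ (λ B → map (B ++_) (Fin⁺ W)) {xs = star 𝒱} C∈)
... | B , B∈ , C∈B++ with ∈-map⁻ (B ++_) C∈B++
...   | D , D∈Fin⁺W , refl with V∈
...     | here refl = let (t , t∈D , t∈W) = Fin⁺-meets D∈Fin⁺W in t , t∈W , ∈-++⁺ʳ B t∈D
...     | there V∈𝒱 = let (t , t∈V , t∈B) = star-meets B∈ V∈𝒱 in t , t∈V , ∈-++⁺ˡ t∈B

star-∷ : {B V : List X} {t : X} {𝒱 : List (List X)} →
         B ∈ star 𝒱 → t ∈ V → (B ++ [ t ]) ∈ star (V ∷ 𝒱)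
star-∷ {B = B} {V} B∈ t∈V =
  ∈-concatMap⁺ (λ B → map (B ++_) (Fin⁺ V)) (lose B∈ (∈-map⁺ (B ++_) [ t∈V ]∈Fin⁺))

data Power : Set where
  base : Power
  L U  : Power → Power

power : Power → PxData → PxData
power base  X = X
power (L c) X = PL (power c X)
power (U c) X = PU (power c X)

module ProxJoinProperties (J : ProxJoinSemilattice) where
  open ProxJoinSemilattice J public
  open IsBoundedJoinSemilattice isBoundedJoinSemilattice public
    using (x≤x∨y; y≤x∨y; ∨-least)
    renaming (refl to ≤-refl; reflexive to ≤-reflexive; trans to ≤-trans; minimum to 𝟘≤)

  ∨-mono : ∀ {x y x' y'} → x ≤ x' → y ≤ y' → (x ∨ y) ≤ (x' ∨ y')
  ∨-mono p q = ∨-least (≤-trans p (x≤x∨y _ _)) (≤-trans q (y≤x∨y _ _))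

  ≺-interpolate : ∀ {x z} → x ≺ z → ∃ λ y → x ≺ y × y ≺ z
  ≺-interpolate {x} {z} = to (RoundedIdeal.rounded (lower-rounded z) x)

  ≺-interpolate² : ∀ {x z} → x ≺ z → ∃ λ p → ∃ λ q → x ≺ p × p ≺ q × q ≺ z
  ≺-interpolate² x≺z =
    let (p , x≺p , p≺z) = ≺-interpolate x≺z ; (q , p≺q , q≺z) = ≺-interpolate p≺z in
    p , q , x≺p , p≺q , q≺z

  ≺-trans : ∀ {x y z} → x ≺ y → y ≺ z → x ≺ z
  ≺-trans {x} {y} {z} p q = from (RoundedIdeal.rounded (lower-rounded z) x) (y , p , q)

  ≤-≺-trans : ∀ {x y z} → x ≤ y → y ≺ z → x ≺ z
  ≤-≺-trans {z = z} = RoundedIdeal.downward (lower-rounded z)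

  ≺-≤-trans : ∀ {x y z} → x ≺ y → y ≤ z → x ≺ z
  ≺-≤-trans {x} p q = RoundedUpper.upward (upper-rounded x) q p

  ∨-≺ : ∀ {x y z} → x ≺ z → y ≺ z → (x ∨ y) ≺ z
  ∨-≺ {z = z} p q with RoundedIdeal.directed (lower-rounded z) p q
  ... | w , w≺z , x≤w , y≤w = ≤-≺-trans (∨-least x≤w y≤w) w≺z

  𝟘≺ : ∀ {z} → 𝟘 ≺ z
  𝟘≺ {z} with RoundedIdeal.inhabited (lower-rounded z)
  ... | w , w≺z = ≤-≺-trans (𝟘≤ w) w≺z

  ⋁ : List S → S
  ⋁ = foldr _∨_ 𝟘

  ∈⇒≤⋁ : ∀ {a A} → a ∈ A → a ≤ ⋁ A
  ∈⇒≤⋁ (here refl) = x≤x∨y _ _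
  ∈⇒≤⋁ (there a∈A) = ≤-trans (∈⇒≤⋁ a∈A) (y≤x∨y _ _)

  ⋁-least : ∀ {A m} → All (_≤ m) A → ⋁ A ≤ m
  ⋁-least []       = 𝟘≤ _
  ⋁-least (p ∷ ps) = ∨-least p (⋁-least ps)

  ⋁-≺ : ∀ {A m} → All (_≺ m) A → ⋁ A ≺ m
  ⋁-≺ []       = 𝟘≺
  ⋁-≺ (p ∷ ps) = ∨-≺ p (⋁-≺ ps)

  ⊆⇒⋁-mono : ∀ {A B} → (∀ {a} → a ∈ A → a ∈ B) → ⋁ A ≤ ⋁ B
  ⊆⇒⋁-mono A⊆B = ⋁-least (All.tabulate (λ a∈A → ∈⇒≤⋁ (A⊆B a∈A)))

  ⋁-++ˡ : ∀ A {B} → ⋁ A ≤ ⋁ (A ++ B)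
  ⋁-++ˡ A {B} = ⊆⇒⋁-mono {A} {A ++ B} ∈-++⁺ˡ

  ⋁-++ʳ : ∀ A {B} → ⋁ B ≤ ⋁ (A ++ B)
  ⋁-++ʳ A {B} = ⊆⇒⋁-mono {B} {A ++ B} (∈-++⁺ʳ A)

  ⋁-++-≤ : ∀ A {B} → ⋁ (A ++ B) ≤ (⋁ A ∨ ⋁ B)
  ⋁-++-≤ A = ⋁-least (All.tabulate λ a∈ →
    Sum.[ (λ a∈A → ≤-trans (∈⇒≤⋁ a∈A) (x≤x∨y _ _)) ,
          (λ a∈B → ≤-trans (∈⇒≤⋁ a∈B) (y≤x∨y _ _)) ] (∈-++⁻ A a∈))

  ⋁-[_] : ∀ x → ⋁ [ x ] ≤ x
  ⋁-[ x ] = ∨-least ≤-refl (𝟘≤ x)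

  ⋁-concat-≤ : ∀ 𝒰 → ⋁ (concat 𝒰) ≤ ⋁ (map ⋁ 𝒰)
  ⋁-concat-≤ 𝒰 = ⋁-least (All.tabulate λ a∈ →
    let (A , a∈A , A∈𝒰) = ∈-concat⁻′ 𝒰 a∈ in ≤-trans (∈⇒≤⋁ a∈A) (∈⇒≤⋁ (∈-map⁺ ⋁ A∈𝒰)))

  ⋁-concat-≥ : ∀ 𝒰 → ⋁ (map ⋁ 𝒰) ≤ ⋁ (concat 𝒰)
  ⋁-concat-≥ 𝒰 = ⋁-least (All.tabulate λ b∈ →
    let (A , A∈𝒰 , b≡⋁A) = ∈-map⁻ ⋁ {xs = 𝒰} b∈ in
    subst (_≤ ⋁ (concat 𝒰)) (sym b≡⋁A) (⊆⇒⋁-mono (λ a∈A → ∈-concat⁺′ a∈A A∈𝒰)))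

  ≤-antisym⇒≺-cong : ∀ {x a b} → a ≤ b → b ≤ a → x ≺ a ⇔ x ≺ b
  ≤-antisym⇒≺-cong a≤b b≤a = mk⇔ (λ p → ≺-≤-trans p a≤b) (λ p → ≺-≤-trans p b≤a)

  Cover : S → (S → Set) → Set
  Cover x G = ∃ λ E → x ≤ ⋁ E × All (λ e → ∃ λ z → e ≺ z × G z) E

  Cover-≤ : ∀ {x y G} → x ≤ y → Cover y G → Cover x G
  Cover-≤ x≤y (E , y≤⋁E , gE) = E , ≤-trans x≤y y≤⋁E , gE

  Cover-𝟘 : ∀ {G} → Cover 𝟘 G
  Cover-𝟘 = [] , 𝟘≤ 𝟘 , []

  Cover-∨ : ∀ {x y G} → Cover x G → Cover y G → Cover (x ∨ y) G
  Cover-∨ (E , x≤ , gE) (F , y≤ , gF) =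
    E ++ F , ∨-least (≤-trans x≤ (⋁-++ˡ E)) (≤-trans y≤ (⋁-++ʳ E)) , Allₚ.++⁺ gE gF

  Cover-pure : ∀ {x z} {G : S → Set} → x ≺ z → G z → Cover x G
  Cover-pure x≺z gz = [ _ ] , x≤x∨y _ _ , (_ , x≺z , gz) ∷ []

  Cover-map : ∀ {x} {G G' : S → Set} → (∀ {z} → G z → G' z) → Cover x G → Cover x G'
  Cover-map f (E , x≤ , gE) = E , x≤ , All.map (λ (z , e≺z , gz) → z , e≺z , f gz) gE

  Cover-bind : ∀ {x} {G G' : S → Set} →
               Cover x G → (∀ {e z} → e ≺ z → G z → Cover e G') → Cover x G'
  Cover-bind {G = G} {G'} (E , x≤⋁E , gE) k = Cover-≤ x≤⋁E (cover-⋁ gE)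
    where
      cover-⋁ : ∀ {E} → All (λ e → ∃ λ z → e ≺ z × G z) E → Cover (⋁ E) G'
      cover-⋁ []                      = Cover-𝟘
      cover-⋁ ((z , e≺z , gz) ∷ gE) = Cover-∨ (k e≺z gz) (cover-⋁ gE)

module CanonicalRelation (J : ProxJoinSemilattice) where
  open ProxJoinProperties J

  ⟪_⟫ : Power → PxData
  ⟪ c ⟫ = power c pxData

  ⟦_⟧ : Power → Set
  ⟦ c ⟧ = Carrier ⟪ c ⟫

  -- The detour through B in η (L c) makes η approximable without strength;
  -- for strong S, η (L base) x A ⇔ x ≺ ⋁ A (η-L-base).
  η : (c : Power) → Rel' S ⟦ c ⟧
  η base  x s = x ≺ s
  η (L c) x A = ∃ λ B → x ≺ ⋁ B × (η c ᴸ) B A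
  η (U c) x A = ∃ λ y → x ≺ y × All (η c y) A

  ≤-η-trans : ∀ c {x y t} → x ≤ y → η c y t → η c x t
  ≤-η-trans base  x≤y y≺t             = ≤-≺-trans x≤y y≺t
  ≤-η-trans (L c) x≤y (B , y≺⋁B , ηBA) = B , ≤-≺-trans x≤y y≺⋁B , ηBA
  ≤-η-trans (U c) x≤y (z , y≺z , ηzA)  = z , ≤-≺-trans x≤y y≺z , ηzA

  ≺-η-trans : ∀ c {x y t} → x ≺ y → η c y t → η c x t
  ≺-η-trans base  x≺y y≺t             = ≺-trans x≺y y≺t
  ≺-η-trans (L c) x≺y (B , y≺⋁B , ηBA) = B , ≺-trans x≺y y≺⋁B , ηBA
  ≺-η-trans (U c) x≺y (z , y≺z , ηzA)  = z , ≺-trans x≺y y≺z , ηzA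

  η-interpolate : ∀ c {x t} → η c x t → ∃ λ y → x ≺ y × η c y t
  η-interpolate base x≺t = ≺-interpolate x≺t
  η-interpolate (L c) (B , x≺⋁B , ηBA) =
    let (y , x≺y , y≺⋁B) = ≺-interpolate x≺⋁B in y , x≺y , B , y≺⋁B , ηBA
  η-interpolate (U c) (z , x≺z , ηzA) =
    let (y , x≺y , y≺z) = ≺-interpolate x≺z in y , x≺y , z , y≺z , ηzA

  ∨-η : ∀ c {x y t} → η c x t → η c y t → η c (x ∨ y) t
  ∨-η base x≺t y≺t = ∨-≺ x≺t y≺t
  ∨-η (L c) (B , x≺⋁B , ηBA) (C , y≺⋁C , ηCA) =
    B ++ C , ∨-≺ (≺-≤-trans x≺⋁B (⋁-++ˡ B)) (≺-≤-trans y≺⋁C (⋁-++ʳ B)) , Allₚ.++⁺ ηBA ηCA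
  ∨-η (U c) (z , x≺z , ηzA) (w , y≺w , ηwA) =
    z ∨ w , ∨-≺ (≺-≤-trans x≺z (x≤x∨y z w)) (≺-≤-trans y≺w (y≤x∨y z w)) ,
    All.zipWith (λ (ηz , ηw) → ∨-η c ηz ηw) (ηzA , ηwA)

  𝟘-η : ∀ c {t} → η c 𝟘 t
  𝟘-η base  = 𝟘≺
  𝟘-η (L c) = [] , 𝟘≺ , []
  𝟘-η (U c) = 𝟘 , 𝟘≺ , All.tabulate (λ _ → 𝟘-η c)

  η-≤-trans : ∀ c {x t t'} → η c x t → Le ⟪ c ⟫ t t' → η c x t'
  η-≤-trans base  x≺t t≤t'             = ≺-≤-trans x≺t t≤t'
  η-≤-trans (L c) (B , x≺⋁B , ηBA) A≤A' = B , x≺⋁B , ᴸ-trans (η-≤-trans c) ηBA A≤A'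
  η-≤-trans (U c) (y , x≺y , ηyA) A≤A'  =
    y , x≺y , All.map (λ a≤ → let (ηya , a≤a') = All.lookupAny ηyA a≤ in η-≤-trans c ηya a≤a') A≤A'

  Commutes : (c d : Power) → Rel' ⟦ c ⟧ ⟦ d ⟧ → Set
  Commutes c d r = ∀ x t → η d x t ⇔ (r ⊙ η c) x t

  η-Commutes : ∀ c → Commutes base c (η c)
  η-Commutes c x t = mk⇔ (η-interpolate c) (λ (y , x≺y , ηyt) → ≺-η-trans c x≺y ηyt)

  Commutes-⊙ : ∀ {c d e r q} → Commutes c d r → Commutes d e q → Commutes c e (q ⊙ r)
  Commutes-⊙ cd de x u = mk⇔
    (λ ηu → let (t , ηt , qtu) = to (de x u) ηu ; (s , ηs , rst) = to (cd x t) ηt in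
            s , ηs , t , rst , qtu)
    (λ (s , ηs , t , rst , qtu) → from (de x u) (t , from (cd x t) (s , ηs , rst) , qtu))

  Commutes-ᴸ : ∀ {c d r} → Commutes c d r → Commutes (L c) (L d) (r ᴸ)
  Commutes-ᴸ cd x A' = mk⇔
    (λ (B , x≺⋁B , ηBA') → let (A , ηBA , rAA') = ᴸ-⊙⁻ (All.map (Any.map (to (cd _ _))) ηBA') in
                           A , (B , x≺⋁B , ηBA) , rAA')
    (λ (A , (B , x≺⋁B , ηBA) , rAA') →
       B , x≺⋁B , ᴸ-trans (λ ηba raa' → from (cd _ _) (_ , ηba , raa')) ηBA rAA')

  Commutes-ᵁ : ∀ {c d r} → Commutes c d r → Commutes (U c) (U d) (r ᵁ)
  Commutes-ᵁ cd x A' = mk⇔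
    (λ (y , x≺y , ηyA') → let (A , ηyA , rAA') = ᵁ-choose (All.map (to (cd _ _)) ηyA') in
                          A , (y , x≺y , ηyA) , rAA')
    (λ (A , (y , x≺y , ηyA) , rAA') → y , x≺y ,
       All.map (λ ra → let (ηya , raa') = All.lookupAny ηyA ra in
                       from (cd _ _) (_ , ηya , raa')) rAA')

  η-rounded : ∀ c → Commutes c c (Prox ⟪ c ⟫)
  η-rounded base  x t = mk⇔ ≺-interpolate (λ (s , x≺s , s≺t) → ≺-trans x≺s s≺t)
  η-rounded (L c) = Commutes-ᴸ {c} {c} (η-rounded c)
  η-rounded (U c) = Commutes-ᵁ {c} {c} (η-rounded c)

  η-approximable : ∀ c → Approximable pxData ⟪ c ⟫ (η c)
  η-approximable c =
    (λ t → record
      { downward  = ≤-η-trans c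
      ; inhabited = 𝟘 , 𝟘-η c
      ; directed  = λ {x} {y} ηx ηy → x ∨ y , ∨-η c ηx ηy , x≤x∨y x y , y≤x∨y x y
      ; rounded   = λ x → mk⇔ (η-interpolate c) (λ (y , x≺y , ηy) → ≺-η-trans c x≺y ηy)
      }) ,
    (λ x → record
      { upward  = λ t≤t' ηt → η-≤-trans c ηt t≤t'
      ; rounded = λ t → mk⇔ (λ ηt → let (s , ηs , s≺t) = to (η-rounded c x t) ηt in s , s≺t , ηs)
                             (λ (s , s≺t , ηs) → from (η-rounded c x t) (s , ηs , s≺t))
      })

  Commutes-εL : Commutes (L base) base (εL pxData)
  Commutes-εL x a = mk⇔
    (λ x≺a → let (x' , x≺x' , x'≺a) = ≺-interpolate x≺a
                 (a' , x'≺a' , a'≺a) = ≺-interpolate x'≺a in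
             [ a' ] , ([ x' ] , ≺-≤-trans x≺x' (x≤x∨y x' 𝟘) , here x'≺a' ∷ []) , here a'≺a ∷ [])
    (λ (A , (B , x≺⋁B , B≺A) , A≺a) → ≺-trans x≺⋁B (⋁-≺ (ᴸ-singleton⁻ (ᴸ-trans ≺-trans B≺A A≺a))))

  Commutes-εU : Commutes (U base) base (εU pxData)
  Commutes-εU x a = mk⇔
    (λ x≺a → let (y , x≺y , y≺a) = ≺-interpolate x≺a ; (a' , y≺a' , a'≺a) = ≺-interpolate y≺a in
             [ a' ] , (y , x≺y , y≺a' ∷ []) , here a'≺a ∷ [])
    (λ { (A , (y , x≺y , y≺A) , (t≺a ∷ [])) →
           let (y≺t , t≺a) = All.lookupAny y≺A t≺a in ≺-trans x≺y (≺-trans y≺t t≺a) })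

  η-UU⇔η-U-concat : ∀ c x 𝒜 → η (U (U c)) x 𝒜 ⇔ η (U c) x (concat 𝒜)
  η-UU⇔η-U-concat c x 𝒜 = mk⇔
    (λ (y , x≺y , η𝒜) → y , x≺y ,
       Allₚ.concat⁺ (All.map (λ (z , y≺z , ηzA) → All.map (≺-η-trans c y≺z) ηzA) η𝒜))
    (λ (y , x≺y , η∪𝒜) → let (x' , x≺x' , x'≺y) = ≺-interpolate x≺y in
       x' , x≺x' , All.map (λ ηyA → y , x'≺y , ηyA) (Allₚ.concat⁻ η∪𝒜))

  Commutes-νU : ∀ c → Commutes (U c) (U (U c)) (νU ⟪ c ⟫)
  Commutes-νU c x 𝒜 = ⇔-trans (η-UU⇔η-U-concat c x 𝒜) (η-rounded (U c) x (concat 𝒜))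

module StrongProperties (J : ProxJoinSemilattice) (strong : Strong J) where
  open ProxJoinProperties J
  open CanonicalRelation J
  open Strong strong

  ≺⋁-split : ∀ {y} A → y ≺ ⋁ A → ∃ λ B → y ≤ ⋁ B × (_≺_ ᴸ) B A
  ≺⋁-split [] y≺𝟘 = [] , ≤-reflexive (≺𝟘 y≺𝟘) , []
  ≺⋁-split (a ∷ A) y≺a∨⋁A with ≺∨ y≺a∨⋁A
  ... | a' , c , y≤a'∨c , a'≺a , c≺⋁A with ≺⋁-split A c≺⋁A
  ...   | B , c≤⋁B , B≺A =
    a' ∷ B , ≤-trans y≤a'∨c (∨-mono ≤-refl c≤⋁B) , here a'≺a ∷ All.map there B≺A

  Represents : (c : Power) → (⟦ c ⟧ → S) → Set
  Represents c v = ∀ x t → η c x t ⇔ x ≺ v t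

  η-L-represented : ∀ {c v} → Represents c v → Represents (L c) (λ A → ⋁ (map v A))
  η-L-represented {v = v} ηv x A = mk⇔
    (λ (B , x≺⋁B , ηBA) → ≺-trans x≺⋁B (⋁-≺ (All.map (λ ηbA →
       let (t , t∈A , ηbt) = find ηbA in ≺-≤-trans (to (ηv _ _) ηbt) (∈⇒≤⋁ (∈-map⁺ v t∈A))) ηBA)))
    (λ x≺⋁vA → let (m , x≺m , m≺⋁vA) = ≺-interpolate x≺⋁vA
                   (B , m≤⋁B , B≺vA) = ≺⋁-split (map v A) m≺⋁vA in
       B , ≺-≤-trans x≺m m≤⋁B , All.map (λ b≺vA → Any.map (from (ηv _ _)) (Anyₚ.map⁻ b≺vA)) B≺vA)

  η-L-base : Represents (L base) ⋁
  η-L-base x A = subst (λ B → η (L base) x A ⇔ x ≺ ⋁ B) (map-id A)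
                       (η-L-represented (λ _ _ → mk⇔ id id) x A)

  Commutes-νL : Commutes (L base) (L (L base)) (νL pxData)
  Commutes-νL x 𝒰 = begin
    η (L (L base)) x 𝒰             ≈⟨ η-L-represented {L base} {⋁} η-L-base x 𝒰 ⟩
    x ≺ ⋁ (map ⋁ 𝒰)               ≈⟨ ≤-antisym⇒≺-cong (⋁-concat-≥ 𝒰) (⋁-concat-≤ 𝒰) ⟩
    x ≺ ⋁ (concat 𝒰)              ≈⟨ ⇔-sym (η-L-base x (concat 𝒰)) ⟩
    η (L base) x (concat 𝒰)        ≈⟨ η-rounded (L base) x (concat 𝒰) ⟩
    (νL pxData ⊙ η (L base)) x 𝒰  ∎
    where open ≈-Reasoning (⇔-setoid 0ℓ)

module Localized⇒Coalgebra
  (J : ProxJoinSemilattice) (strong : Strong J) (localized : Localized J) where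
  open ProxJoinProperties J
  open CanonicalRelation J
  open StrongProperties J strong
  open Strong strong

  ≺∨-cover : ∀ {a y p q} → a ≺ y → y ≺ (p ∨ q) → Cover a (λ z → z ≺ y × (z ≺ p ⊎ z ≺ q))
  ≺∨-cover a≺y y≺p∨q with ≺-interpolate a≺y | ≺∨ y≺p∨q
  ... | a₀ , a≺a₀ , a₀≺y | p' , q' , y≤p'∨q' , p'≺p , q'≺q with localized a₀≺y y≤p'∨q'
  ...   | a₁ , a₂ , a₁≺y , a₁≺p' , a₂≺y , a₂≺q' , a₀≺a₁∨a₂ with ≺∨ (≺-trans a≺a₀ a₀≺a₁∨a₂)
  ...     | e₁ , e₂ , a≤e₁∨e₂ , e₁≺a₁ , e₂≺a₂ =
    Cover-≤ a≤e₁∨e₂ (Cover-∨ (Cover-pure e₁≺a₁ (a₁≺y , inj₁ (≺-trans a₁≺p' p'≺p)))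
                             (Cover-pure e₂≺a₂ (a₂≺y , inj₂ (≺-trans a₂≺q' q'≺q))))

  -- Proximity form of  ⋀_{p ∈ P} (p ∨ w) ≤ (⋀ P) ∨ w.
  cover-⋀∨ : ∀ P w {x y} → x ≺ y → All (λ p → y ≺ (p ∨ w)) P →
             Cover x (λ z → z ≺ y × (z ≺ w ⊎ All (z ≺_) P))
  cover-⋀∨ [] w x≺y [] =
    let (z , x≺z , z≺y) = ≺-interpolate x≺y in Cover-pure x≺z (z≺y , inj₂ [])
  cover-⋀∨ (p ∷ P) w {y = y} x≺y (y≺p∨w ∷ y≺P∨w) = Cover-bind (≺∨-cover x≺y y≺p∨w) step
    where
      step : ∀ {e z} → e ≺ z → z ≺ y × (z ≺ p ⊎ z ≺ w) →
             Cover e (λ z' → z' ≺ y × (z' ≺ w ⊎ All (z' ≺_) (p ∷ P)))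
      step e≺z (z≺y , inj₂ z≺w) = Cover-pure e≺z (z≺y , inj₁ z≺w)
      step e≺z (z≺y , inj₁ z≺p) = Cover-map
        (λ { (z'≺z , inj₁ z'≺w) → ≺-trans z'≺z z≺y , inj₁ z'≺w
           ; (z'≺z , inj₂ z'≺P) → ≺-trans z'≺z z≺y , inj₂ (≺-trans z'≺z z≺p ∷ z'≺P) })
        (cover-⋀∨ P w e≺z (All.map (≺-trans z≺y) y≺P∨w))

  -- Proximity form of  ⋀_{w ∈ W, p ∈ P} (p ∨ w) ≤ (⋀ W) ∨ (⋀ P).
  cover-⋀∨⋀ : ∀ W P {x y} → x ≺ y → All (λ w → All (λ p → y ≺ (p ∨ w)) P) W →
              Cover x (λ z → z ≺ y × (All (z ≺_) W ⊎ All (z ≺_) P))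
  cover-⋀∨⋀ [] P x≺y [] =
    let (z , x≺z , z≺y) = ≺-interpolate x≺y in Cover-pure x≺z (z≺y , inj₁ [])
  cover-⋀∨⋀ (w ∷ W) P {y = y} x≺y (y≺P∨w ∷ y≺P∨W) = Cover-bind (cover-⋀∨⋀ W P x≺y y≺P∨W) step
    where
      step : ∀ {e z} → e ≺ z → z ≺ y × (All (z ≺_) W ⊎ All (z ≺_) P) →
             Cover e (λ z' → z' ≺ y × (All (z' ≺_) (w ∷ W) ⊎ All (z' ≺_) P))
      step e≺z (z≺y , inj₂ z≺P) = Cover-pure e≺z (z≺y , inj₂ z≺P)
      step e≺z (z≺y , inj₁ z≺W) = Cover-map
        (λ { (z'≺z , inj₁ z'≺w) → ≺-trans z'≺z z≺y , inj₁ (z'≺w ∷ All.map (≺-trans z'≺z) z≺W)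
           ; (z'≺z , inj₂ z'≺P) → ≺-trans z'≺z z≺y , inj₂ z'≺P })
        (cover-⋀∨ P w e≺z (All.map (≺-trans z≺y) y≺P∨w))

  module Distributivity (c : Power) (v : ⟦ c ⟧ → S) (ηv : Represents c v) where

    ηLv : Represents (L c) (λ A → ⋁ (map v A))
    ηLv = η-L-represented {c} {v} ηv

    ⋁-map-∷ʳ : ∀ B t → ⋁ (map v (B ++ [ t ])) ≤ (⋁ (map v B) ∨ v t)
    ⋁-map-∷ʳ B t = subst (λ D → ⋁ D ≤ (⋁ (map v B) ∨ v t)) (sym (map-++ v B [ t ]))
                         (≤-trans (⋁-++-≤ (map v B)) (∨-mono ≤-refl ⋁-[ v t ]))

    -- Proximity form of  ⋀_{C ∈ 𝒱*} ⋁ C ≤ ⋁_{V ∈ 𝒱} ⋀ V.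
    cover-⋀⋁ : ∀ 𝒱 {x y} → x ≺ y → (∀ {C} → C ∈ star 𝒱 → y ≺ ⋁ (map v C)) →
               Cover x (λ z → Any (All (λ t → z ≺ v t)) 𝒱)
    cover-⋀⋁ [] x≺y y≺⋁𝒱* = Cover-≤ (≤-reflexive (≺𝟘 (≺-trans x≺y (y≺⋁𝒱* (here refl))))) Cover-𝟘
    cover-⋀⋁ (V ∷ 𝒱) {y = y} x≺y y≺⋁𝒱* = Cover-bind (cover-⋀∨⋀ (map v V) P x≺y y≺P∨V) step
      where
        P : List S
        P = map (λ B → ⋁ (map v B)) (star 𝒱)

        y≺P∨V : All (λ w → All (λ p → y ≺ (p ∨ w)) P) (map v V)
        y≺P∨V = Allₚ.map⁺ (All.tabulate λ {t} t∈V → Allₚ.map⁺ (All.tabulate λ {B} B∈𝒱* →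
                  ≺-≤-trans (y≺⋁𝒱* (star-∷ {𝒱 = 𝒱} B∈𝒱* t∈V)) (⋁-map-∷ʳ B t)))

        step : ∀ {e z} → e ≺ z → z ≺ y × (All (z ≺_) (map v V) ⊎ All (z ≺_) P) →
               Cover e (λ z' → Any (All (λ t → z' ≺ v t)) (V ∷ 𝒱))
        step e≺z (_ , inj₁ z≺V) = Cover-pure e≺z (here (Allₚ.map⁻ z≺V))
        step e≺z (_ , inj₂ z≺P) =
          Cover-map there (cover-⋀⋁ 𝒱 e≺z (All.lookup (Allₚ.map⁻ z≺P)))

    η-LU⇒η-UL-star : ∀ {x} 𝒱 → η (L (U c)) x 𝒱 → η (U (L c)) x (star 𝒱)
    η-LU⇒η-UL-star 𝒱 (B , x≺⋁B , ηB𝒱) =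
      let (y , x≺y , y≺⋁B) = ≺-interpolate x≺⋁B in
      y , x≺y , All.tabulate (λ C∈𝒱* → from (ηLv y _) (≺-trans y≺⋁B (⋁-≺ (All.map (≺⋁ C∈𝒱*) ηB𝒱))))
      where
        ≺⋁ : ∀ {C b} → C ∈ star 𝒱 → Any (η (U c) b) 𝒱 → b ≺ ⋁ (map v C)
        ≺⋁ C∈𝒱* ηb𝒱 with find ηb𝒱
        ... | V , V∈𝒱 , z , b≺z , ηzV with star-meets C∈𝒱* V∈𝒱
        ...   | t , t∈V , t∈C =
          ≺-trans b≺z (≺-≤-trans (to (ηv _ _) (All.lookup ηzV t∈V)) (∈⇒≤⋁ (∈-map⁺ v t∈C)))

    η-UL-star⇒η-LU : ∀ {x} 𝒱 → η (U (L c)) x (star 𝒱) → η (L (U c)) x 𝒱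
    η-UL-star⇒η-LU 𝒱 (y , x≺y , ηy𝒱*) with ≺-interpolate x≺y
    ... | x' , x≺x' , x'≺y with cover-⋀⋁ 𝒱 x'≺y (λ C∈𝒱* → to (ηLv y _) (All.lookup ηy𝒱* C∈𝒱*))
    ...   | E , x'≤⋁E , coverE =
      E , ≺-≤-trans x≺x' x'≤⋁E ,
      All.map (λ (z , e≺z , z≺𝒱) →
                 Any.map (λ z≺vV → z , e≺z , All.map (from (ηv _ _)) z≺vV) z≺𝒱) coverE

    Commutes-σ : Commutes (U (L c)) (L (U c)) (σ ⟪ c ⟫)
    Commutes-σ x 𝒱 = ⇔-trans (mk⇔ (η-LU⇒η-UL-star 𝒱) (η-UL-star⇒η-LU 𝒱))
                              (η-rounded (U (L c)) x (star 𝒱))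

  open Distributivity (L base) ⋁ η-L-base using (Commutes-σ)

  α : Rel' S (List (List S))
  α = η (U (L base))

  Commutes-εH : Commutes (U (L base)) base (εH pxData)
  Commutes-εH = Commutes-⊙ {U (L base)} {U base} {base}
    (Commutes-ᵁ {L base} {base} Commutes-εL) Commutes-εU

  Commutes-νH : Commutes (U (L base)) (U (L (U (L base)))) (νH pxData)
  Commutes-νH = Commutes-⊙ {U (L base)} {U (U (L (L base)))} {U (L (U (L base)))}
    (Commutes-⊙ {U (L base)} {U (L (L base))} {U (U (L (L base)))}
      (Commutes-ᵁ {L base} {L (L base)} Commutes-νL) (Commutes-νU (L (L base))))
    (Commutes-ᵁ {U (L (L base))} {L (U (L base))} Commutes-σ)

  Commutes-Hα : Commutes (U (L base)) (U (L (U (L base)))) (Hmap {pxData} {H pxData} α)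
  Commutes-Hα = Commutes-ᵁ {L base} {L (U (L base))}
    (Commutes-ᴸ {base} {U (L base)} (η-Commutes (U (L base))))

  isHCoalgebra : IsHCoalgebra pxData α
  isHCoalgebra = record
    { approximable = η-approximable (U (L base))
    ; counit-law   = λ x y → ⇔-sym (Commutes-εH x y)
    ; comult-law   = λ x 𝒲 → ⇔-trans (⇔-sym (Commutes-νH x 𝒲)) (Commutes-Hα x 𝒲)
    }

module Coalgebra⇒Localized
  (J : ProxJoinSemilattice) (strong : Strong J)
  (α : Rel' (ProxJoinSemilattice.S J) (List (List (ProxJoinSemilattice.S J))))
  (isHCoalgebra : IsHCoalgebra (ProxJoinSemilattice.pxData J) α) where
  open ProxJoinProperties J
  open StrongProperties J strong using (≺⋁-split)
  open Strong strong
  open IsHCoalgebra isHCoalgebra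

  α-downward : ∀ {x y 𝒰} → x ≤ y → α y 𝒰 → α x 𝒰
  α-downward {𝒰 = 𝒰} = RoundedIdeal.downward (proj₁ approximable 𝒰)

  α-interpolate : ∀ {x 𝒰} → α x 𝒰 → ∃ λ y → x ≺ y × α y 𝒰
  α-interpolate {x} {𝒰} = to (RoundedIdeal.rounded (proj₁ approximable 𝒰) x)

  α-⋁ : ∀ {𝒰 E} → All (λ e → α e 𝒰) E → α (⋁ E) 𝒰
  α-⋁ {𝒰} [] = let (w , αw) = RoundedIdeal.inhabited (proj₁ approximable 𝒰) in α-downward (𝟘≤ w) αw
  α-⋁ {𝒰} (αe ∷ αE) with RoundedIdeal.directed (proj₁ approximable 𝒰) αe (α-⋁ αE)
  ... | w , αw , e≤w , ⋁E≤w = α-downward (∨-least e≤w ⋁E≤w) αw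

  α-upward : ∀ {x 𝒰 𝒱} → Le (H pxData) 𝒰 𝒱 → α x 𝒰 → α x 𝒱
  α-upward {x} = RoundedUpper.upward (proj₂ approximable x)

  α-≺-upward : ∀ {x 𝒰 𝒱} → Prox (H pxData) 𝒰 𝒱 → α x 𝒰 → α x 𝒱
  α-≺-upward {x} {𝒰} {𝒱} 𝒰≺𝒱 αx𝒰 =
    from (RoundedUpper.rounded (proj₂ approximable x) 𝒱) (𝒰 , 𝒰≺𝒱 , αx𝒰)

  α-interpolateʳ : ∀ {x 𝒱} → α x 𝒱 → ∃ λ 𝒰 → Prox (H pxData) 𝒰 𝒱 × α x 𝒰
  α-interpolateʳ {x} {𝒱} = to (RoundedUpper.rounded (proj₂ approximable x) 𝒱)

  ≺⇒α-point : ∀ {x a} → x ≺ a → α x [ [ a ] ]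
  ≺⇒α-point {x} {a} x≺a with from (counit-law x a) x≺a
  ... | 𝒰 , αx𝒰 , B , 𝒰εLB , (B≺a ∷ []) with find B≺a
  ...   | t , t∈B , t≺a =
    α-≺-upward (Any.map (λ A≺t → ᴸ-trans ≺-trans A≺t (here t≺a ∷ [])) (All.lookup 𝒰εLB t∈B) ∷ [])
               αx𝒰

  α-point⇒≺ : ∀ {x a} → α x [ [ a ] ] → x ≺ a
  α-point⇒≺ {x} {a} αx with α-interpolateʳ αx
  ... | 𝒰 , (𝒰≺a ∷ []) , αx𝒰 with find 𝒰≺a
  ...   | A , A∈𝒰 , A≺a with ≺-interpolate (⋁-≺ (ᴸ-singleton⁻ A≺a))
  ...     | m , ⋁A≺m , m≺a = to (counit-law x a)
    (𝒰 , αx𝒰 , [ m ] , lose A∈𝒰 (All.tabulate (λ t∈A → here (≤-≺-trans (∈⇒≤⋁ t∈A) ⋁A≺m))) ∷ [] ,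
     here m≺a ∷ [])

  α⇒≺⋁ : ∀ {x 𝒰 A} → α x 𝒰 → A ∈ 𝒰 → x ≺ ⋁ A
  α⇒≺⋁ αx𝒰 A∈𝒰 = α-point⇒≺ (α-upward (lose A∈𝒰 (All.tabulate (λ a∈A → here (∈⇒≤⋁ a∈A))) ∷ []) αx𝒰)

  α⇒≺-all-⋁ : ∀ {x 𝒰} → α x 𝒰 → ∃ λ z → x ≺ z × All (λ A → z ≺ ⋁ A) 𝒰
  α⇒≺-all-⋁ αx𝒰 = let (z , x≺z , αz𝒰) = α-interpolate αx𝒰 in z , x≺z , All.tabulate (α⇒≺⋁ αz𝒰)

  ≺⋁⇒α : ∀ {x A} → x ≺ ⋁ A → α x [ A ]
  ≺⋁⇒α {x} {A} x≺⋁A =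
    let (B , x≤⋁B , B≺A) = ≺⋁-split A x≺⋁A in α-downward x≤⋁B (α-⋁ (All.map ≺A⇒α B≺A))
    where
      ≺A⇒α : ∀ {b} → Any (b ≺_) A → α b [ A ]
      ≺A⇒α b≺A = let (a , a∈A , b≺a) = find b≺A in
        α-upward (here (lose a∈A ≤-refl ∷ []) ∷ []) (≺⇒α-point b≺a)

  νH-choice : ∀ {𝒰 𝒲 𝔚 C} → νH pxData 𝒰 𝒲 → 𝔚 ∈ 𝒲 → C ∈ star 𝔚 →
              Any (λ A → (_≺_ ᴸ) A (concat C)) 𝒰
  νH-choice (𝒱 , (𝒰₁ , 𝒰νL𝒰₁ , 𝒰₁νU𝒱) , 𝒱σ𝒲) 𝔚∈𝒲 C∈𝔚* with find (All.lookup 𝒱σ𝒲 𝔚∈𝒲)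
  ... | 𝔘 , 𝔘∈𝒱 , 𝔘σ𝔚 with find (All.lookup 𝔘σ𝔚 C∈𝔚*)
  ...   | C' , C'∈𝔘 , C'≺C with find (All.lookup 𝒰₁νU𝒱 (∈-concat⁺′ C'∈𝔘 𝔘∈𝒱))
  ...     | 𝔅 , 𝔅∈𝒰₁ , 𝔅≺C' =
    Any.map (λ A≺∪𝔅 → ᴸ-trans ≺-trans A≺∪𝔅 (ᴸ-concat (ᴸ-trans (ᴸ-trans ≺-trans) 𝔅≺C' C'≺C)))
            (All.lookup 𝒰νL𝒰₁ 𝔅∈𝒰₁)

  α-meet : ∀ {a a' A B} → a ≺ a' → α a' [ A ] → α a' [ B ] → α a (A ∷ B ∷ [])
  α-meet {a} {a'} {A} {B} a≺a' αA αB
    with from (comult-law a 𝒲)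
              ([ [ a' ] ] , ≺⇒α-point a≺a' , here (here αA ∷ []) ∷ here (here αB ∷ []) ∷ [])
    where
      𝒲 : List (List (List (List S)))
      𝒲 = [ [ A ] ] ∷ [ [ B ] ] ∷ []
  ... | 𝒰 , αa𝒰 , 𝒰νH𝒲 =
    α-≺-upward (concat-[] (νH-choice 𝒰νH𝒲 (here refl) (here refl)) ∷
                concat-[] (νH-choice 𝒰νH𝒲 (there (here refl)) (here refl)) ∷ []) αa𝒰
    where
      concat-[] : ∀ {D} → Any (λ A' → (_≺_ ᴸ) A' (concat [ D ])) 𝒰 →
                  Any (λ A' → (_≺_ ᴸ) A' D) 𝒰
      concat-[] {D} = Any.map (subst ((_≺_ ᴸ) _) (++-identityʳ D))

  -- Reading 𝒰 ∈ P_U (P_L X) as ⋀_{A ∈ 𝒰} ⋁ A, and dually in P_L (P_U X), these are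
  -- b ∧ (c ∨ d) and (b ∧ c) ∨ (b ∧ d), with the points of P_L X as atoms.
  meet-of-joins : S → S → S → List (List (List S))
  meet-of-joins b c d = [ [ b ] ] ∷ ([ c ] ∷ [ d ] ∷ []) ∷ []

  join-of-meets : S → S → S → List (List (List S))
  join-of-meets b c d = ([ b ] ∷ [ c ] ∷ []) ∷ ([ b ] ∷ [ d ] ∷ []) ∷ []

  σ-distrib : ∀ {b c d b' c' d'} → b' ≺ b → c' ≺ c → d' ≺ d →
              σ (PL pxData) (meet-of-joins b' c' d') (join-of-meets b c d)
  σ-distrib {b} {c} {d} b'≺b c'≺c d'≺d = All.tabulate choice
    where
      choice : ∀ {C} → C ∈ star (join-of-meets b c d) →
               Any (λ C' → ((_≺_ ᴸ) ᴸ) C' C) (meet-of-joins _ _ _)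
      choice {C} C∈ with star-meets {C = C} {𝒱 = join-of-meets b c d} C∈ (here refl)
                       | star-meets {C = C} {𝒱 = join-of-meets b c d} C∈ (there (here refl))
      ... | _ , here refl , b∈C | _ = here (lose b∈C (here b'≺b ∷ []) ∷ [])
      ... | _ , there (here refl) , _ | _ , here refl , b∈C = here (lose b∈C (here b'≺b ∷ []) ∷ [])
      ... | _ , there (here refl) , c∈C | _ , there (here refl) , d∈C =
        there (here (lose c∈C (here c'≺c ∷ []) ∷ lose d∈C (here d'≺d ∷ []) ∷ []))

  BelowMeet : S → S → S → Set
  BelowMeet e b c = ∃ λ z → e ≺ z × z ≺ b × z ≺ c

  Split : S → S → S → S → Set
  Split a b c d = ∃ λ a₁ → ∃ λ a₂ → (a₁ ≺ b) × (a₁ ≺ c) × (a₂ ≺ b) × (a₂ ≺ d) × (a ≺ (a₁ ∨ a₂))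

  Split-𝟘 : ∀ {b c d} → Split 𝟘 b c d
  Split-𝟘 = 𝟘 , 𝟘 , 𝟘≺ , 𝟘≺ , 𝟘≺ , 𝟘≺ , 𝟘≺

  Split-∨ : ∀ {x y b c d} → Split x b c d → Split y b c d → Split (x ∨ y) b c d
  Split-∨ (a₁ , a₂ , a₁≺b , a₁≺c , a₂≺b , a₂≺d , x≺)
          (a₁' , a₂' , a₁'≺b , a₁'≺c , a₂'≺b , a₂'≺d , y≺) =
    a₁ ∨ a₁' , a₂ ∨ a₂' , ∨-≺ a₁≺b a₁'≺b , ∨-≺ a₁≺c a₁'≺c , ∨-≺ a₂≺b a₂'≺b , ∨-≺ a₂≺d a₂'≺d ,
    ∨-≺ (≺-≤-trans x≺ (∨-mono (x≤x∨y a₁ a₁') (x≤x∨y a₂ a₂')))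
        (≺-≤-trans y≺ (∨-mono (y≤x∨y a₁ a₁') (y≤x∨y a₂ a₂')))

  Split-⋁ : ∀ {E b c d} → All (λ e → Split e b c d) E → Split (⋁ E) b c d
  Split-⋁ []               = Split-𝟘
  Split-⋁ (splitE ∷ splitsE) = Split-∨ splitE (Split-⋁ splitsE)

  ≺-Split : ∀ {x y b c d} → x ≺ y → Split y b c d → Split x b c d
  ≺-Split x≺y (a₁ , a₂ , a₁≺b , a₁≺c , a₂≺b , a₂≺d , y≺) =
    a₁ , a₂ , a₁≺b , a₁≺c , a₂≺b , a₂≺d , ≺-trans x≺y y≺

  α-BelowMeet : ∀ {e b c} → α e ([ b ] ∷ [ c ] ∷ []) → BelowMeet e b c
  α-BelowMeet αe with α⇒≺-all-⋁ αe
  ... | z , e≺z , (z≺b ∷ z≺c ∷ []) = z , e≺z , ≺-≤-trans z≺b ⋁-[ _ ] , ≺-≤-trans z≺c ⋁-[ _ ]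

  α-join-of-meets⇒Split : ∀ {e b c d} → Any (α e) (join-of-meets b c d) → Split e b c d
  α-join-of-meets⇒Split (here αe) =
    let (z , e≺z , z≺b , z≺c) = α-BelowMeet αe in
    z , 𝟘 , z≺b , z≺c , 𝟘≺ , 𝟘≺ , ≺-≤-trans e≺z (x≤x∨y z 𝟘)
  α-join-of-meets⇒Split (there (here αe)) =
    let (z , e≺z , z≺b , z≺d) = α-BelowMeet αe in
    𝟘 , z , 𝟘≺ , 𝟘≺ , z≺b , z≺d , ≺-≤-trans e≺z (y≤x∨y 𝟘 z)

  νH-meet-of-joins : ∀ {a y c' d' b c d} → α a ([ y ] ∷ (c' ∷ d' ∷ []) ∷ []) →
                     y ≺ b → c' ≺ c → d' ≺ d → (νH pxData ⊙ α) a [ join-of-meets b c d ]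
  νH-meet-of-joins αa y≺b c'≺c d'≺d
    with ≺-interpolate² y≺b | ≺-interpolate² c'≺c | ≺-interpolate² d'≺d
  ... | b₁ , b₂ , y≺b₁ , b₁≺b₂ , b₂≺b
      | c₁ , c₂ , c'≺c₁ , c₁≺c₂ , c₂≺c
      | d₁ , d₂ , d'≺d₁ , d₁≺d₂ , d₂≺d =
    _ , αa , [ meet-of-joins b₂ c₂ d₂ ] ,
    (meet-of-joins b₁ c₁ d₁ ,
      (here (here y≺b₁ ∷ []) ∷ there (here (here c'≺c₁ ∷ there (here d'≺d₁) ∷ [])) ∷ []) ,
      (here (here (here b₁≺b₂ ∷ []) ∷ []) ∷
       there (here (here (here c₁≺c₂ ∷ []) ∷ there (here (here d₁≺d₂ ∷ [])) ∷ [])) ∷ [])) ,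
    here (σ-distrib b₂≺b c₂≺c d₂≺d) ∷ []

  α-split : ∀ {a y c' d' b c d} → α a ([ y ] ∷ (c' ∷ d' ∷ []) ∷ []) → y ≺ b → c' ≺ c → d' ≺ d →
            Split a b c d
  α-split {a} {b = b} {c} {d} αa y≺b c'≺c d'≺d
    with to (comult-law a [ join-of-meets b c d ]) (νH-meet-of-joins αa y≺b c'≺c d'≺d)
  ... | 𝒰 , αa𝒰 , (Hα ∷ []) with find Hα
  ...   | A , A∈𝒰 , αA = ≺-Split (α⇒≺⋁ αa𝒰 A∈𝒰) (Split-⋁ (All.map α-join-of-meets⇒Split αA))

  localized : Localized J
  localized a≺b b≤c∨d with ≺-interpolate² a≺b
  ... | a' , y , a≺a' , a'≺y , y≺b with ≺∨ (≺-≤-trans y≺b b≤c∨d)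
  ...   | c' , d' , y≤c'∨d' , c'≺c , d'≺d =
    α-split (α-meet a≺a' (≺⇒α-point a'≺y) (≺⋁⇒α (≺-≤-trans a'≺y y≤⋁c'd'))) y≺b c'≺c d'≺d
    where
      y≤⋁c'd' : y ≤ ⋁ (c' ∷ d' ∷ [])
      y≤⋁c'd' = ≤-trans y≤c'∨d' (∨-mono ≤-refl (x≤x∨y d' 𝟘))

proposition3p55 : (S : ProxJoinSemilattice) → Strong S →
    (Localized S ⇔ (∃ λ α → IsHCoalgebra (ProxJoinSemilattice.pxData S) α))
proposition3p55 S strong = mk⇔ coalgebra localized
  where
    open ProxJoinSemilattice S using (pxData)

    coalgebra : Localized S → ∃ λ α → IsHCoalgebra pxData α
    coalgebra loc = α , isHCoalgebra
      where open Localized⇒Coalgebra S strong loc using (α; isHCoalgebra)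

    localized : (∃ λ α → IsHCoalgebra pxData α) → Localized S
    localized (α , isHCoalgebra) = Coalgebra⇒Localized.localized S strong α isHCoalgebra
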